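{- Let $\tau$ be a finite self-nested unordered rooted tree. Then the number of vertices $\#\mathcal{V}(\tau)$ can be computed from the height profile $\rho_\tau$ in $O(\mathcal{H}(\tau)^2)$ operations.
   Context: For a vertex $v$ of $\tau$, $\mathcal{C}_\tau(v)$ is its set of children and $\tau[v]$ the subtree rooted at $v$. Heights: $\mathcal{H}(v)=0$ for a leaf, $\mathcal{H}(v)=1+\max_{w\in\mathcal{C}_\tau(v)}\mathcal{H}(w)$ otherwise; $\mathcal{H}(\tau[v])=\mathcal{H}(v)$, and $\mathcal{H}(\tau)$ is the height of the root. A tree is self-nested if all its subtrees of the same height are isomorphic. For a vertex $v$, $\gamma_h(v)$ is the number of children $v'$ of $v$ with $\mathcal{H}(\tau[v'])=h$. For $0\le h_2<h_1\le\mathcal{H}(\tau)$, $\rho_\tau(h_1,h_2)$ is the vector of the values $\gamma_{h_2}(v)$ over all vertices $v$ with $\mathcal{H}(\tau[v])=h_1$ (in a fixed traversal order). For a self-nested tree all components of each $\rho_\tau(h_1,h_2)$ are equal, and the height profile is identified with the integer array whose $(h_1,h_2)$ entry is this common value. -}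

module Defs where

open import Data.Nat using (ℕ; zero; suc; _+_; _*_; _⊔_; _≟_)
open import Data.Fin using (Fin)
open import Data.List using (List; []; _∷_; _++_; length; filter; map)
open import Data.Vec using (Vec; lookup) renaming ([] to []ᵥ; _∷_ to _∷ᵥ_)
open import Data.Vec as V using ()
open import Relation.Binary.PropositionalEquality using (_≡_)

-- Finite rooted trees (children stored in a list; the order is
-- irrelevant: isomorphism below is up to reordering of children).

data Tree : Set where
  node : List Tree → Tree

mutual
  height : Tree → ℕ
  height (node []) = 0
  height (node ts@(_ ∷ _)) = suc (maxHeight ts)

  maxHeight : List Tree → ℕ
  maxHeight [] = 0
  maxHeight (t ∷ ts) = height t ⊔ maxHeight ts

mutual
  size : Tree → ℕ
  size (node ts) = suc (sizes ts)

  sizes : List Tree → ℕ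
  sizes [] = 0
  sizes (t ∷ ts) = size t + sizes ts

-- the subtrees τ[v], one for each vertex v, in preorder traversal
mutual
  subtrees : Tree → List Tree
  subtrees (node ts) = node ts ∷ subtreesL ts

  subtreesL : List Tree → List Tree
  subtreesL [] = []
  subtreesL (t ∷ ts) = subtrees t ++ subtreesL ts

-- isomorphism of unordered rooted trees: children matched up to
-- reordering (multiset matching)
mutual
  data _≅_ : Tree → Tree → Set where
    node : ∀ {ts us} → ts ≅L us → node ts ≅ node us

  data _≅L_ : List Tree → List Tree → Set where
    []  : [] ≅L []
    _∷_ : ∀ {t u ts us₁ us₂} → t ≅ u → ts ≅L (us₁ ++ us₂) →
          (t ∷ ts) ≅L (us₁ ++ u ∷ us₂)

data _∈_ {A : Set} (x : A) : List A → Set where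
  here  : ∀ {xs} → x ∈ (x ∷ xs)
  there : ∀ {y xs} → x ∈ xs → x ∈ (y ∷ xs)

SelfNested : Tree → Set
SelfNested τ = ∀ {s s'} → s ∈ subtrees τ → s' ∈ subtrees τ →
               height s ≡ height s' → s ≅ s'

γ : ℕ → Tree → ℕ
γ h (node ts) = length (filter (λ t → height t ≟ h) ts)

ρ : Tree → ℕ → ℕ → List ℕ
ρ τ h₁ h₂ = map (γ h₂) (filter (λ s → height s ≟ h₁) (subtrees τ))

headOr0 : List ℕ → ℕ
headOr0 [] = 0
headOr0 (x ∷ _) = x

-- height profile as an integer array: the (h1,h2) entry is the common
-- value of the components of ρ_τ(h1,h2) (for self-nested τ); taken as
-- the first component, 0 if the vector is empty.
profile : Tree → ℕ → ℕ → ℕ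
profile τ h₁ h₂ = headOr0 (ρ τ h₁ h₂)

-- Cost model: straight-line arithmetic programs.  Each instruction is
-- one operation; it may be a constant, a read of an entry of the
-- height profile, or an addition / multiplication of earlier results.

data Instr (n : ℕ) : Set where
  lit   : ℕ → Instr n
  entry : ℕ → ℕ → Instr n
  add   : Fin n → Fin n → Instr n
  mul   : Fin n → Fin n → Instr n

data SLP : ℕ → Set where
  []  : SLP 0
  _▷_ : ∀ {n} → SLP n → Instr n → SLP (suc n)

-- values of all instructions (most recent first), given the array read by 'entry'
eval : ∀ {n} → (ℕ → ℕ → ℕ) → SLP n → Vec ℕ n
eval A [] = []ᵥ
eval A (p ▷ i) = step i ∷ᵥ vs
  where
  vs = eval A p
  step : _ → ℕ
  step (lit k) = k
  step (entry a b) = A a b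
  step (add x y) = lookup vs x + lookup vs y
  step (mul x y) = lookup vs x * lookup vs y

run : ∀ {n} → (ℕ → ℕ → ℕ) → SLP (suc n) → ℕ
run A p = V.head (eval A p)

-- All vertices of a self-nested tree having height h root isomorphic subtrees, hence have the
-- same number N(h) of vertices, and the profile row h is the child-height count of any one of
-- them. Grouping the children of such a vertex by height gives N(0) = 1 and
-- N(h) = 1 + Σ_{i<h} ρ(h,i) N(i). A straight-line program evaluates this recurrence for
-- h = 1, …, H with three operations (read ρ(h,i), multiply, add) per term, O(H²) in all.

module Submission where

open import Data.Bool using (true; false; if_then_else_)
open import Data.Fin using (Fin; zero; suc)
open import Data.List using (List; []; _∷_; _++_; _∷ʳ_; length; map; filter; applyUpTo)
open import Data.List.Properties using (applyUpTo-∷ʳ; map-++; length-++; length-map)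
open import Data.List.Membership.Propositional using () renaming (_∈_ to _∈ₗ_)
open import Data.List.Membership.Propositional.Properties
  using (∈-++⁺ˡ; ∈-++⁺ʳ; ∈-++⁻; ∈-filter⁺; ∈-filter⁻)
open import Data.List.Relation.Unary.All as All using (All; []; _∷_)
open import Data.List.Relation.Unary.Any using (here; there)
open import Data.Nat using (ℕ; zero; suc; _+_; _*_; _≤_; _<_; _≟_; _≡ᵇ_; z≤n; s≤s)
open import Data.Nat.Induction using (<-rec)
open import Data.Nat.ListAction using (sum)
open import Data.Nat.Properties
  using (+-identityʳ; +-assoc; +-comm; +-commutativeSemigroup; ≤-trans; ≤-reflexive;
         m≤m⊔n; m≤n⊔m; m≤m+n; +-monoʳ-≤)
open import Data.Nat.Tactic.RingSolver using (solve-∀)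
open import Algebra.Properties.CommutativeSemigroup +-commutativeSemigroup using (interchange; x∙yz≈y∙xz)
open import Data.Product using (Σ; ∃-syntax; _×_; _,_; proj₁; proj₂)
open import Data.Sum using ([_,_])
open import Data.Vec using (lookup)
open import Function using (_∘_; id)
open import Relation.Binary.PropositionalEquality
  using (_≡_; refl; sym; trans; cong; cong₂; subst; module ≡-Reasoning)

open import Defs

open ≡-Reasoning

sumBelow : ℕ → (ℕ → ℕ) → ℕ
sumBelow zero    f = 0
sumBelow (suc n) f = f 0 + sumBelow n (f ∘ suc)

syntax sumBelow n (λ i → e) = ∑[ i < n ] e

∑-cong : ∀ n {f g : ℕ → ℕ} → (∀ i → f i ≡ g i) → ∑[ i < n ] f i ≡ ∑[ i < n ] g i
∑-cong zero    f≗g = refl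
∑-cong (suc n) f≗g = cong₂ _+_ (f≗g 0) (∑-cong n (f≗g ∘ suc))

∑-zero : ∀ n → ∑[ i < n ] 0 ≡ 0
∑-zero zero    = refl
∑-zero (suc n) = ∑-zero n

∑-distrib-+ : ∀ n (f g : ℕ → ℕ) → ∑[ i < n ] (f i + g i) ≡ ∑[ i < n ] f i + ∑[ i < n ] g i
∑-distrib-+ zero    f g = refl
∑-distrib-+ (suc n) f g = begin
  (f 0 + g 0) + ∑[ i < n ] (f (suc i) + g (suc i))
    ≡⟨ cong (f 0 + g 0 +_) (∑-distrib-+ n (f ∘ suc) (g ∘ suc)) ⟩
  (f 0 + g 0) + (∑[ i < n ] f (suc i) + ∑[ i < n ] g (suc i))
    ≡⟨ interchange (f 0) (g 0) _ _ ⟩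
  (f 0 + ∑[ i < n ] f (suc i)) + (g 0 + ∑[ i < n ] g (suc i)) ∎

∑-select : ∀ {a n} (g : ℕ → ℕ) → a < n → ∑[ i < n ] (if a ≡ᵇ i then g i else 0) ≡ g a
∑-select {zero}  {suc n} g _         = trans (cong (g 0 +_) (∑-zero n)) (+-identityʳ (g 0))
∑-select {suc a} {suc n} g (s≤s a<n) = ∑-select (g ∘ suc) a<n

length-filter-∷ : ∀ {X : Set} (f : X → ℕ) i x xs c →
  length (filter (λ y → f y ≟ i) (x ∷ xs)) * c ≡
  (if f x ≡ᵇ i then c else 0) + length (filter (λ y → f y ≟ i) xs) * c
length-filter-∷ f i x xs c with f x ≡ᵇ i
... | true  = refl
... | false = refl

sum-map-fibres : ∀ {X : Set} (f : X → ℕ) (g : ℕ → ℕ) {n} (xs : List X) → All (λ x → f x < n) xs →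
  sum (map (g ∘ f) xs) ≡ ∑[ i < n ] (length (filter (λ x → f x ≟ i) xs) * g i)
sum-map-fibres f g {n} []       []            = sym (∑-zero n)
sum-map-fibres f g {n} (x ∷ xs) (fx<n ∷ f<n) = begin
  g (f x) + sum (map (g ∘ f) xs)
    ≡⟨ cong₂ _+_ (sym (∑-select g fx<n)) (sum-map-fibres f g xs f<n) ⟩
  ∑[ i < n ] (if f x ≡ᵇ i then g i else 0) + ∑[ i < n ] (count i xs * g i)
    ≡⟨ sym (∑-distrib-+ n _ _) ⟩
  ∑[ i < n ] ((if f x ≡ᵇ i then g i else 0) + count i xs * g i)
    ≡⟨ ∑-cong n (λ i → sym (length-filter-∷ f i x xs (g i))) ⟩
  ∑[ i < n ] (count i (x ∷ xs) * g i) ∎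
  where
  count : ℕ → List _ → ℕ
  count i ys = length (filter (λ y → f y ≟ i) ys)

dot : (ℕ → ℕ) → List ℕ → ℕ
dot c []       = 0
dot c (x ∷ xs) = c 0 * x + dot (c ∘ suc) xs

dot-applyUpTo : ∀ (c g : ℕ → ℕ) n → dot c (applyUpTo g n) ≡ ∑[ i < n ] (c i * g i)
dot-applyUpTo c g zero    = refl
dot-applyUpTo c g (suc n) = cong (c 0 * g 0 +_) (dot-applyUpTo (c ∘ suc) (g ∘ suc) n)

-- sizeAt A h is the number of vertices of a self-nested tree of height h with height profile A.
mutual
  sizeTable : (ℕ → ℕ → ℕ) → ℕ → List ℕ
  sizeTable A zero    = sizeAt A zero ∷ []
  sizeTable A (suc h) = sizeTable A h ∷ʳ sizeAt A (suc h)

  sizeAt : (ℕ → ℕ → ℕ) → ℕ → ℕ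
  sizeAt A zero    = 1
  sizeAt A (suc h) = suc (dot (A (suc h)) (sizeTable A h))

sizeTable≡applyUpTo : ∀ A h → sizeTable A h ≡ applyUpTo (sizeAt A) (suc h)
sizeTable≡applyUpTo A zero    = refl
sizeTable≡applyUpTo A (suc h) =
  trans (cong (_∷ʳ sizeAt A (suc h)) (sizeTable≡applyUpTo A h)) (applyUpTo-∷ʳ (sizeAt A) (suc h))

sizeAt-suc : ∀ A h → sizeAt A (suc h) ≡ suc (∑[ i < suc h ] (A (suc h) i * sizeAt A i))
sizeAt-suc A h = cong suc (begin
  dot (A (suc h)) (sizeTable A h)                 ≡⟨ cong (dot (A (suc h))) (sizeTable≡applyUpTo A h) ⟩
  dot (A (suc h)) (applyUpTo (sizeAt A) (suc h))  ≡⟨ dot-applyUpTo (A (suc h)) (sizeAt A) (suc h) ⟩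
  ∑[ i < suc h ] (A (suc h) i * sizeAt A i)       ∎)

data _⊑_ : ∀ {m n} → SLP m → SLP n → Set where
  ⊑-refl : ∀ {m} {p : SLP m} → p ⊑ p
  ⊑-step : ∀ {m n} {p : SLP m} {q : SLP n} {i : Instr n} → p ⊑ q → p ⊑ (q ▷ i)

⊑-trans : ∀ {l m n} {o : SLP l} {p : SLP m} {q : SLP n} → o ⊑ p → p ⊑ q → o ⊑ q
⊑-trans o⊑p ⊑-refl       = o⊑p
⊑-trans o⊑p (⊑-step p⊑q) = ⊑-step (⊑-trans o⊑p p⊑q)

weaken : ∀ {m n} {p : SLP m} {q : SLP n} → p ⊑ q → Fin m → Fin n
weaken ⊑-refl       r = r
weaken (⊑-step p⊑q) r = suc (weaken p⊑q r)

lookup-weaken : ∀ A {m n} {p : SLP m} {q : SLP n} (p⊑q : p ⊑ q) (r : Fin m) →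
  lookup (eval A q) (weaken p⊑q r) ≡ lookup (eval A p) r
lookup-weaken A ⊑-refl       r = refl
lookup-weaken A (⊑-step p⊑q) r = lookup-weaken A p⊑q r

lookup-zero : ∀ A {n} (p : SLP (suc n)) → lookup (eval A p) zero ≡ run A p
lookup-zero A (p ▷ i) = refl

record Extension {n} (p : SLP n) : Set where
  constructor extension
  field
    {len}   : ℕ
    program : SLP (suc len)
    extends : p ⊑ program

open Extension

-- For the j-th register r (a position in p₀), appends three instructions computing
-- acc + A h (col j) * r, where acc is the current last value.
emitDot : ∀ {k n} {p₀ : SLP k} → ℕ → (ℕ → ℕ) → List (Fin k) → (p : SLP (suc n)) → p₀ ⊑ p →
          Extension p
emitDot h col []       p p₀⊑p = extension p ⊑-refl
emitDot h col (r ∷ rs) p p₀⊑p =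
  extension (program rest) (⊑-trans (⊑-step (⊑-step (⊑-step ⊑-refl))) (extends rest))
  where
  q = ((p ▷ entry h (col 0)) ▷ mul zero (suc (weaken p₀⊑p r))) ▷ add (suc (suc zero)) zero
  rest = emitDot h (col ∘ suc) rs q (⊑-step (⊑-step (⊑-step p₀⊑p)))

run-emitDot : ∀ A h col {k n} {p₀ : SLP k} rs (p : SLP (suc n)) (p₀⊑p : p₀ ⊑ p) →
  run A (program (emitDot h col rs p p₀⊑p)) ≡ run A p + dot (A h ∘ col) (map (lookup (eval A p₀)) rs)
run-emitDot A h col []       p p₀⊑p = sym (+-identityʳ (run A p))
run-emitDot A h col {p₀ = p₀} (r ∷ rs) p p₀⊑p = begin
  run A (program (emitDot h (col ∘ suc) rs q _))
    ≡⟨ run-emitDot A h (col ∘ suc) rs q _ ⟩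
  (lookup (eval A p) zero + a * lookup (eval A p) (weaken p₀⊑p r)) + rest
    ≡⟨ cong₂ (λ acc x → acc + a * x + rest) (lookup-zero A p) (lookup-weaken A p₀⊑p r) ⟩
  (run A p + a * value r) + rest
    ≡⟨ +-assoc (run A p) (a * value r) rest ⟩
  run A p + dot (A h ∘ col) (map value (r ∷ rs)) ∎
  where
  q = ((p ▷ entry h (col 0)) ▷ mul zero (suc (weaken p₀⊑p r))) ▷ add (suc (suc zero)) zero
  a = A h (col 0)
  value = lookup (eval A p₀)
  rest = dot (A h ∘ col ∘ suc) (map value rs)

len-emitDot : ∀ h col {k n} {p₀ : SLP k} rs (p : SLP (suc n)) (p₀⊑p : p₀ ⊑ p) →
  len (emitDot h col rs p p₀⊑p) ≡ length rs * 3 + n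
len-emitDot h col []       p p₀⊑p = refl
len-emitDot h col {n = n} (r ∷ rs) p p₀⊑p =
  trans (len-emitDot h (col ∘ suc) rs _ _) (x∙yz≈y∙xz (length rs * 3) 3 n)

record Stage : Set where
  constructor stage
  field
    {len}     : ℕ
    program   : SLP (suc len)
    registers : List (Fin (suc len))

extendStage : ℕ → Stage → Stage
extendStage h (stage p rs) =
  stage (program E) (map (weaken (⊑-trans (⊑-step ⊑-refl) (extends E))) rs ∷ʳ zero)
  where E = emitDot h id rs (p ▷ lit 1) (⊑-step ⊑-refl)

build : ℕ → Stage
build zero    = stage ([] ▷ lit 1) (zero ∷ [])
build (suc h) = extendStage (suc h) (build h)

registerValues : (ℕ → ℕ → ℕ) → Stage → List ℕ
registerValues A (stage p rs) = map (lookup (eval A p)) rs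

run-extendStage : ∀ A h s → run A (Stage.program (extendStage h s)) ≡ suc (dot (A h) (registerValues A s))
run-extendStage A h (stage p rs) = run-emitDot A h id rs (p ▷ lit 1) (⊑-step ⊑-refl)

registerValues-extendStage : ∀ A h s →
  registerValues A (extendStage h s) ≡ registerValues A s ∷ʳ run A (Stage.program (extendStage h s))
registerValues-extendStage A h (stage p rs) = begin
  map (lookup (eval A q)) (map (weaken p⊑q) rs ∷ʳ zero)
    ≡⟨ map-++ (lookup (eval A q)) (map (weaken p⊑q) rs) (zero ∷ []) ⟩
  map (lookup (eval A q)) (map (weaken p⊑q) rs) ∷ʳ lookup (eval A q) zero
    ≡⟨ cong₂ _∷ʳ_ (lookup-weaken-map rs) (lookup-zero A q) ⟩
  map (lookup (eval A p)) rs ∷ʳ run A q ∎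
  where
  E = emitDot h id rs (p ▷ lit 1) (⊑-step ⊑-refl)
  q = program E
  p⊑q = ⊑-trans (⊑-step ⊑-refl) (extends E)
  lookup-weaken-map : ∀ rs → map (lookup (eval A q)) (map (weaken p⊑q) rs) ≡ map (lookup (eval A p)) rs
  lookup-weaken-map []       = refl
  lookup-weaken-map (r ∷ rs) = cong₂ _∷_ (lookup-weaken A p⊑q r) (lookup-weaken-map rs)

mutual
  registerValues-build : ∀ A h → registerValues A (build h) ≡ sizeTable A h
  registerValues-build A zero    = refl
  registerValues-build A (suc h) =
    trans (registerValues-extendStage A (suc h) (build h))
          (cong₂ _∷ʳ_ (registerValues-build A h) (run-build A (suc h)))

  run-build : ∀ A h → run A (Stage.program (build h)) ≡ sizeAt A h
  run-build A zero    = refl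
  run-build A (suc h) =
    trans (run-extendStage A (suc h) (build h)) (cong (suc ∘ dot (A (suc h))) (registerValues-build A h))

length-registers-build : ∀ h → length (Stage.registers (build h)) ≡ suc h
length-registers-build zero    = refl
length-registers-build (suc h) with build h | length-registers-build h
... | stage p rs | |rs|≡1+h = begin
  length (map _ rs ++ zero ∷ [])  ≡⟨ length-++ (map _ rs) ⟩
  length (map _ rs) + 1           ≡⟨ cong (_+ 1) (trans (length-map _ rs) |rs|≡1+h) ⟩
  suc h + 1                       ≡⟨ +-comm (suc h) 1 ⟩
  suc (suc h)                     ∎

len-build-suc : ∀ h → Stage.len (build (suc h)) ≡ suc h * 3 + suc (Stage.len (build h))
len-build-suc h with build h | length-registers-build h
... | stage p rs | |rs|≡1+h =
  trans (len-emitDot (suc h) id rs (p ▷ lit 1) (⊑-step ⊑-refl)) (cong (λ k → k * 3 + _) |rs|≡1+h)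

len-build-bound : ∀ h → suc (Stage.len (build h)) ≤ 2 * (suc h * suc h)
len-build-bound zero    = s≤s z≤n
len-build-bound (suc h) = begin-≤
  suc (Stage.len (build (suc h)))                 ≤⟨ ≤-reflexive (cong suc (len-build-suc h)) ⟩
  suc (suc h * 3 + suc (Stage.len (build h)))     ≤⟨ s≤s (+-monoʳ-≤ (suc h * 3) (len-build-bound h)) ⟩
  suc (suc h * 3 + 2 * (suc h * suc h))           ≤⟨ m≤m+n _ (2 + h) ⟩
  suc (suc h * 3 + 2 * (suc h * suc h)) + (2 + h) ≤⟨ ≤-reflexive (square-step h) ⟩
  2 * (suc (suc h) * suc (suc h))                 ≤∎
  where
  open Data.Nat.Properties.≤-Reasoning using (step-≤) renaming (begin_ to begin-≤_; _∎ to _≤∎)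
  square-step : ∀ h → suc (suc h * 3 + 2 * (suc h * suc h)) + (2 + h) ≡ 2 * (suc (suc h) * suc (suc h))
  square-step = solve-∀

∈ₗ⇒∈ : ∀ {A : Set} {x : A} {xs} → x ∈ₗ xs → x ∈ xs
∈ₗ⇒∈ (here refl) = here
∈ₗ⇒∈ (there x∈) = there (∈ₗ⇒∈ x∈)

self∈subtrees : ∀ τ → τ ∈ₗ subtrees τ
self∈subtrees (node ts) = here refl

child∈subtreesL : ∀ {t ts} → t ∈ₗ ts → t ∈ₗ subtreesL ts
child∈subtreesL {ts = u ∷ us} (here refl) = ∈-++⁺ˡ (self∈subtrees u)
child∈subtreesL {ts = u ∷ us} (there t∈)  = ∈-++⁺ʳ (subtrees u) (child∈subtreesL t∈)

mutual
  subtrees-trans : ∀ {x s} τ → x ∈ₗ subtrees s → s ∈ₗ subtrees τ → x ∈ₗ subtrees τ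
  subtrees-trans (node us) x∈ (here refl) = x∈
  subtrees-trans (node us) x∈ (there s∈)  = there (subtreesL-trans us x∈ s∈)

  subtreesL-trans : ∀ {x s} us → x ∈ₗ subtrees s → s ∈ₗ subtreesL us → x ∈ₗ subtreesL us
  subtreesL-trans (u ∷ us) x∈ s∈ =
    [ (λ s∈u → ∈-++⁺ˡ (subtrees-trans u x∈ s∈u)) , (λ s∈us → ∈-++⁺ʳ (subtrees u) (subtreesL-trans us x∈ s∈us)) ]
      (∈-++⁻ (subtrees u) s∈)

child∈subtrees : ∀ {τ t ts} → node ts ∈ₗ subtrees τ → t ∈ₗ ts → t ∈ₗ subtrees τ
child∈subtrees {τ} s∈ t∈ = subtrees-trans τ (there (child∈subtreesL t∈)) s∈

height≤maxHeight : ∀ {t ts} → t ∈ₗ ts → height t ≤ maxHeight ts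
height≤maxHeight {ts = u ∷ us} (here refl) = m≤m⊔n (height u) (maxHeight us)
height≤maxHeight {ts = u ∷ us} (there t∈)  = ≤-trans (height≤maxHeight t∈) (m≤n⊔m (height u) (maxHeight us))

height-child< : ∀ {t ts} → t ∈ₗ ts → height t < height (node ts)
height-child< {ts = _ ∷ _} t∈ = s≤s (height≤maxHeight t∈)

sizes-insert : ∀ us₁ u us₂ → sizes (us₁ ++ u ∷ us₂) ≡ size u + sizes (us₁ ++ us₂)
sizes-insert []        u us₂ = refl
sizes-insert (v ∷ us₁) u us₂ =
  trans (cong (size v +_) (sizes-insert us₁ u us₂)) (x∙yz≈y∙xz (size v) (size u) _)

mutual
  size-≅ : ∀ {s s'} → s ≅ s' → size s ≡ size s'
  size-≅ (node ts≅us) = cong suc (sizes-≅ ts≅us)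

  sizes-≅ : ∀ {ts us} → ts ≅L us → sizes ts ≡ sizes us
  sizes-≅ []                                       = refl
  sizes-≅ (_∷_ {u = u} {us₁ = us₁} {us₂} t≅u ts≅us) =
    trans (cong₂ _+_ (size-≅ t≅u) (sizes-≅ ts≅us)) (sym (sizes-insert us₁ u us₂))

sizes≡sum : ∀ {g : Tree → ℕ} ts → All (λ t → size t ≡ g t) ts → sizes ts ≡ sum (map g ts)
sizes≡sum []       []          = refl
sizes≡sum (t ∷ ts) (eq ∷ eqs) = cong₂ _+_ eq (sizes≡sum ts eqs)

size-node : ∀ A ts → (∀ i → γ i (node ts) ≡ A (height (node ts)) i) →
  All (λ t → size t ≡ sizeAt A (height t)) ts → size (node ts) ≡ sizeAt A (height (node ts))
size-node A []         row children = refl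
size-node A ts@(_ ∷ _) row children = trans (cong suc (begin
  sizes ts                                     ≡⟨ sizes≡sum ts children ⟩
  sum (map (sizeAt A ∘ height) ts)             ≡⟨ sum-map-fibres height (sizeAt A) ts (All.tabulate height-child<) ⟩
  ∑[ i < suc m ] (γ i (node ts) * sizeAt A i)  ≡⟨ ∑-cong (suc m) (λ i → cong (_* sizeAt A i) (row i)) ⟩
  ∑[ i < suc m ] (A (suc m) i * sizeAt A i)    ∎)) (sym (sizeAt-suc A m))
  where m = maxHeight ts

profile-witness : ∀ {τ s} → s ∈ₗ subtrees τ →
  ∃[ s₀ ] (s₀ ∈ₗ subtrees τ × height s₀ ≡ height s × (∀ i → profile τ (height s) i ≡ γ i s₀))
-- s lies in the list of vertices of height (height s), which is therefore nonempty.
profile-witness {τ} {s} s∈ with filter (λ u → height u ≟ height s) (subtrees τ) in eq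
                              | ∈-filter⁺ (λ u → height u ≟ height s) s∈ refl
... | s₀ ∷ _ | _ = s₀ , proj₁ s₀∈row , proj₂ s₀∈row , λ i → refl
  where s₀∈row = ∈-filter⁻ (λ u → height u ≟ height s) (subst (s₀ ∈ₗ_) (sym eq) (here refl))

size-subtree : ∀ {τ} → SelfNested τ → ∀ {s} → s ∈ₗ subtrees τ → size s ≡ sizeAt (profile τ) (height s)
size-subtree {τ} selfNested s∈ = <-rec P step _ s∈ refl
  where
  A = profile τ
  P : ℕ → Set
  P h = ∀ {s} → s ∈ₗ subtrees τ → height s ≡ h → size s ≡ sizeAt A h
  step : ∀ h → (∀ {h'} → h' < h → P h') → P h
  step _ ih {s} s∈ refl with profile-witness s∈
  ... | node ts , s₀∈ , hs₀≡hs , row = begin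
    size s                        ≡⟨ size-≅ (selfNested (∈ₗ⇒∈ s∈) (∈ₗ⇒∈ s₀∈) (sym hs₀≡hs)) ⟩
    size (node ts)                ≡⟨ size-node A ts row′ (All.tabulate child) ⟩
    sizeAt A (height (node ts))   ≡⟨ cong (sizeAt A) hs₀≡hs ⟩
    sizeAt A (height s)           ∎
    where
    row′ : ∀ i → γ i (node ts) ≡ A (height (node ts)) i
    row′ i = sym (trans (cong (λ h → A h i) hs₀≡hs) (row i))
    child : ∀ {t} → t ∈ₗ ts → size t ≡ sizeAt A (height t)
    child t∈ = ih (subst (_ <_) hs₀≡hs (height-child< t∈)) (child∈subtrees s₀∈ t∈) refl

proposition4 : Σ ℕ λ c → Σ (ℕ → Σ ℕ λ k → SLP (suc k)) λ alg →
    (∀ H → suc (proj₁ (alg H)) ≤ c * (suc H * suc H)) ×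
    (∀ τ → SelfNested τ → run (profile τ) (proj₂ (alg (height τ))) ≡ size τ)
proposition4 = 2 , algorithm , len-build-bound , correct
  where
  algorithm : ℕ → Σ ℕ λ k → SLP (suc k)
  algorithm H = Stage.len (build H) , Stage.program (build H)
  correct : ∀ τ → SelfNested τ → run (profile τ) (Stage.program (build (height τ))) ≡ size τ
  correct τ selfNested =
    trans (run-build (profile τ) (height τ)) (sym (size-subtree selfNested (self∈subtrees τ)))
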